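{- For $a\in\{4,5,6\}$ and for every integer $a\ge 8$, $$ n(a,a+4,a+5,a+6)=\begin{cases} \frac{a^2+12 a+48}{12}&\text{if } a\equiv 0\pmod 6,\\ \frac{a^2+12 a+35}{12}&\text{if } a\equiv 1\pmod 6,\\ \frac{a^2+12 a+32}{12}&\text{if } a\equiv 2\pmod 6,\\ \frac{a^2+12 a+27}{12}&\text{if } a\equiv 3\pmod 6,\\ \frac{a^2+12 a+32}{12}&\text{if } a\equiv 4\pmod 6,\\ \frac{a^2+12 a+35}{12}&\text{if } a\equiv 5\pmod 6. \end{cases} $$
   Context: For positive integers $a_1,\dots,a_m$ with $\gcd(a_1,\dots,a_m)=1$, the Sylvester number $n(a_1,\dots,a_m)$ is the number of positive integers that cannot be written as $x_1a_1+\cdots+x_ma_m$ with nonnegative integers $x_i$. -}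

module Defs where

open import Data.Nat using (ℕ; zero; suc; _+_; _*_; _%_; _≤_)
open import Data.List using (List; []; _∷_; length; zipWith)
open import Data.Nat.ListAction using (sum)
open import Data.List.Membership.Propositional using (_∈_)
open import Data.List.Relation.Unary.Unique.Propositional using (Unique)
open import Data.Product using (Σ; _×_)
open import Relation.Binary.PropositionalEquality using (_≡_)
open import Relation.Nullary using (¬_)
open import Function.Bundles using (_⇔_)

Representable : List ℕ → ℕ → Set
Representable as m =
  Σ (List ℕ) λ xs → (length xs ≡ length as) × (sum (zipWith _*_ xs as) ≡ m)

-- `IsSylvesterNumber as N`: the set of positive integers that are not
-- representable by `as` is finite and has exactly N elements, i.e. it is
-- enumerated by a duplicate-free list of length N.
IsSylvesterNumber : List ℕ → ℕ → Set
IsSylvesterNumber as N =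
  Σ (List ℕ) λ L →
    Unique L × (length L ≡ N) ×
    (∀ m → (m ∈ L) ⇔ ((1 ≤ m) × ¬ Representable as m))

constTerm : ℕ → ℕ
constTerm 0 = 48
constTerm 1 = 35
constTerm 2 = 32
constTerm 3 = 27
constTerm 4 = 32
constTerm _ = 35

-- For a ≥ 8 write m = q·a + r with r < a. Since the other generators are a + 4, a + 5 and a + 6,
-- m is representable exactly when m = k·a + s where s is a sum of at most k numbers from
-- {4, 5, 6}; such sums are 0 and every s ≥ 4 except 7, using ⌈s/6⌉ terms. Hence q·a + r is
-- representable iff q ≥ ⌈r/6⌉, or q ≥ 1 + ⌈(a + r)/6⌉ when r ∈ {1, 2, 3, 7}, and the number of
-- gaps is the sum of these thresholds over r < a. The sum grows by a + 9 when a grows by 6, so the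
-- formula follows from the cases a = 8, …, 13. For a = 4, 5, 6 the gaps below 16, 18, 26 are
-- found by a decision procedure; above that bound a consecutive integers are representable,
-- hence all are.
module Submission where

open import Defs
open import Data.Nat
  using (ℕ; zero; suc; _+_; _*_; _∸_; _%_; _/_; _≤_; _<_; _≤?_; _<?_; _≟_; NonZero; z≤n; s≤s)
open import Data.Empty using (⊥-elim)
open import Data.List using (List; []; _∷_; length; upTo; applyUpTo; filter; _++_)
open import Data.List.Properties using (length-++; length-applyUpTo)
open import Data.List.Membership.Propositional using (_∈_)
open import Data.List.Membership.Propositional.Properties
  using (∈-++⁺ˡ; ∈-++⁺ʳ; ∈-++⁻; ∈-applyUpTo⁺; ∈-applyUpTo⁻; ∈-filter⁺; ∈-filter⁻; ∈-upTo⁺)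
open import Data.List.Relation.Unary.Any using (here; there)
open import Data.List.Relation.Unary.Unique.Propositional using (Unique; [])
open import Data.List.Relation.Unary.Unique.Propositional.Properties
  using (++⁺; applyUpTo⁺₁; filter⁺; upTo⁺)
open import Data.List.Membership.DecPropositional _≟_ using (_∈?_; _∉_)
open import Data.Nat.DivMod using (m≡m%n+[m/n]*n; m%n<n; [m+kn]%n≡m%n; [m+n]%n≡m%n; m<n⇒m%n≡m)
open import Data.Nat.Properties
open import Data.Nat.Tactic.RingSolver using (solve; solve-∀)
open import Data.Product using (Σ; ∃-syntax; _×_; _,_; -,_)
open import Data.Sum using (_⊎_; inj₁; inj₂)
open import Function using (_∘_)
open import Function.Bundles using (_⇔_; mk⇔; Equivalence)
open import Relation.Binary.Definitions using (tri<; tri≈; tri>)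
open import Relation.Binary.PropositionalEquality
open import Relation.Nullary using (¬_; yes; no; ¬?)
open import Relation.Nullary.Decidable
  using (map′; _×-dec_; True; False; toWitness; toWitnessFalse)
open import Relation.Unary using (Decidable)

open Equivalence using (to; from)

∷-representable : ∀ {g gs n} x → Representable gs n → Representable (g ∷ gs) (x * g + n)
∷-representable x (xs , len , eq) = x ∷ xs , cong suc len , cong (x * _ +_) eq

∷-representable⁻ : ∀ {g gs m} → Representable (g ∷ gs) m →
  ∃[ x ] ∃[ n ] (Representable gs n × x * g + n ≡ m)
∷-representable⁻ (x ∷ xs , len , eq) = x , _ , (xs , suc-injective len , refl) , eq

representable-zero : ∀ as → Representable as 0
representable-zero []       = [] , refl , refl
representable-zero (g ∷ gs) = ∷-representable 0 (representable-zero gs)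

nonrepresentable⇒positive : ∀ {as m} → ¬ Representable as m → 1 ≤ m
nonrepresentable⇒positive {as} {zero}  ¬rep = ⊥-elim (¬rep (representable-zero as))
nonrepresentable⇒positive {m = suc _} _    = s≤s z≤n

representable-+* : ∀ {g gs m} q → Representable (g ∷ gs) m → Representable (g ∷ gs) (q * g + m)
representable-+* {g} q rep with x , n , rep′ , refl ← ∷-representable⁻ rep =
  subst (Representable _) eq (∷-representable (q + x) rep′)
  where
  eq : (q + x) * g + n ≡ q * g + (x * g + n)
  eq = solve (q ∷ x ∷ g ∷ n ∷ [])

-- The bound x ≤ m needs g ≠ 0; for g = 0 the coefficient is replaced by 0.
∷-representable-bounded : ∀ g {gs m} → Representable (g ∷ gs) m →
  ∃[ x ] (x ≤ m × x * g ≤ m × Representable gs (m ∸ x * g))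
∷-representable-bounded zero rep with x , n , rep′ , refl ← ∷-representable⁻ rep =
  0 , z≤n , z≤n , subst (Representable _) (cong (_+ n) (sym (*-zeroʳ x))) rep′
∷-representable-bounded g@(suc _) rep with x , n , rep′ , refl ← ∷-representable⁻ rep =
  x , ≤-trans (m≤m*n x g) (m≤m+n _ n) , m≤m+n _ n ,
  subst (Representable _) (sym (m+n∸m≡n (x * g) n)) rep′

representable? : ∀ as → Decidable (Representable as)
representable? [] m = map′ from′ to′ (0 ≟ m)
  where
  from′ : 0 ≡ m → Representable [] m
  from′ refl = [] , refl , refl
  to′ : Representable [] m → 0 ≡ m
  to′ ([] , _ , eq) = eq
representable? (g ∷ gs) m =
  map′ from′ to′ (anyUpTo? (λ x → x * g ≤? m ×-dec representable? gs (m ∸ x * g)) (suc m))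
  where
  from′ : ∃[ x ] (x < suc m × x * g ≤ m × Representable gs (m ∸ x * g)) → Representable (g ∷ gs) m
  from′ (x , _ , xg≤m , rep) =
    subst (Representable (g ∷ gs)) (m+[n∸m]≡n xg≤m) (∷-representable x rep)
  to′ : Representable (g ∷ gs) m → ∃[ x ] (x < suc m × x * g ≤ m × Representable gs (m ∸ x * g))
  to′ rep with x , x≤m , xg≤m , rep′ ← ∷-representable-bounded g rep = x , s≤s x≤m , xg≤m , rep′

representable-≥ : ∀ {g gs} c .{{_ : NonZero g}} →
  (∀ {i} → i < g → Representable (g ∷ gs) (c + i)) → ∀ n → Representable (g ∷ gs) (c + n)
representable-≥ {g} c base n =
  subst (Representable _) eq (representable-+* (n / g) (base (m%n<n n g)))
  where
  eq : n / g * g + (c + n % g) ≡ c + n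
  eq = trans (trans (+-comm (n / g * g) _) (+-assoc c (n % g) _))
             (cong (c +_) (sym (m≡m%n+[m/n]*n n g)))

gapsBelow : List ℕ → ℕ → List ℕ
gapsBelow as c = filter (¬? ∘ representable? as) (upTo c)

gapsBelow-isSylvesterNumber : ∀ as c → (∀ n → Representable as (c + n)) →
  IsSylvesterNumber as (length (gapsBelow as c))
gapsBelow-isSylvesterNumber as c rep≥c =
  gapsBelow as c , filter⁺ gap? (upTo⁺ c) , refl , λ m → mk⇔ (gap⇒ m) (⇒gap m)
  where
  gap? = ¬? ∘ representable? as
  gap⇒ : ∀ m → m ∈ gapsBelow as c → 1 ≤ m × ¬ Representable as m
  gap⇒ m m∈ with _ , ¬rep ← ∈-filter⁻ gap? {xs = upTo c} m∈ = nonrepresentable⇒positive ¬rep , ¬rep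
  ⇒gap : ∀ m → 1 ≤ m × ¬ Representable as m → m ∈ gapsBelow as c
  ⇒gap m (_ , ¬rep) with m <? c
  ... | yes m<c = ∈-filter⁺ gap? (∈-upTo⁺ m<c) ¬rep
  ... | no  m≮c = ⊥-elim (¬rep (subst (Representable as) (m+[n∸m]≡n (≮⇒≥ m≮c)) (rep≥c (m ∸ c))))

isSylvesterNumber-byComputation : ∀ g gs c .{{_ : NonZero g}} →
  {True (allUpTo? (λ i → representable? (g ∷ gs) (c + i)) g)} →
  IsSylvesterNumber (g ∷ gs) (length (gapsBelow (g ∷ gs) c))
isSylvesterNumber-byComputation g gs c {base} =
  gapsBelow-isSylvesterNumber (g ∷ gs) c (representable-≥ c (toWitness base))

∑< : ℕ → (ℕ → ℕ) → ℕ
∑< zero    f = 0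
∑< (suc n) f = ∑< n f + f n

syntax ∑< n (λ i → e) = ∑[ i < n ] e

∑-+ : ∀ m n (f : ℕ → ℕ) → ∑[ i < m + n ] f i ≡ ∑[ i < m ] f i + ∑[ j < n ] f (m + j)
∑-+ m zero    f rewrite +-identityʳ m = sym (+-identityʳ _)
∑-+ m (suc n) f rewrite +-suc m n =
  trans (cong (_+ f (m + n)) (∑-+ m n f)) (+-assoc (∑[ i < m ] f i) _ (f (m + n)))

residue-unique : ∀ {a q q′ r r′} .{{_ : NonZero a}} → r < a → r′ < a →
  q * a + r ≡ q′ * a + r′ → r ≡ r′
residue-unique {a} {q} {q′} {r} {r′} r<a r′<a eq = begin
  r                 ≡⟨ m<n⇒m%n≡m r<a ⟨
  r % a             ≡⟨ [m+kn]%n≡m%n r q a ⟨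
  (r + q * a) % a   ≡⟨ cong (_% a) (trans (+-comm r _) (trans eq (+-comm _ r′))) ⟩
  (r′ + q′ * a) % a ≡⟨ [m+kn]%n≡m%n r′ q′ a ⟩
  r′ % a            ≡⟨ m<n⇒m%n≡m r′<a ⟩
  r′                ∎
  where open ≡-Reasoning

gapsByResidue : ℕ → (ℕ → ℕ) → ℕ → List ℕ
gapsByResidue a level zero    = []
gapsByResidue a level (suc r) =
  gapsByResidue a level r ++ applyUpTo (λ q → q * a + r) (level r)

module _ (a : ℕ) (level : ℕ → ℕ) where

  length-gapsByResidue : ∀ n → length (gapsByResidue a level n) ≡ ∑[ r < n ] level r
  length-gapsByResidue zero    = refl
  length-gapsByResidue (suc n) =
    trans (length-++ (gapsByResidue a level n))
          (cong₂ _+_ (length-gapsByResidue n) (length-applyUpTo _ (level n)))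

  ∈-gapsByResidue⁺ : ∀ n {q r} → r < n → q < level r → q * a + r ∈ gapsByResidue a level n
  ∈-gapsByResidue⁺ (suc n) r<1+n q<level with m<1+n⇒m<n∨m≡n r<1+n
  ... | inj₁ r<n  = ∈-++⁺ˡ (∈-gapsByResidue⁺ n r<n q<level)
  ... | inj₂ refl = ∈-++⁺ʳ (gapsByResidue a level n) (∈-applyUpTo⁺ (λ q → q * a + n) q<level)

  ∈-gapsByResidue⁻ : ∀ n {m} → m ∈ gapsByResidue a level n →
    ∃[ q ] ∃[ r ] (r < n × q < level r × m ≡ q * a + r)
  ∈-gapsByResidue⁻ (suc n) m∈ with ∈-++⁻ (gapsByResidue a level n) m∈
  ... | inj₁ m∈′ with q , r , r<n , q<level , eq ← ∈-gapsByResidue⁻ n m∈′ =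
    q , r , m<n⇒m<1+n r<n , q<level , eq
  ... | inj₂ m∈′ with q , q<level , eq ← ∈-applyUpTo⁻ (λ q → q * a + n) m∈′ =
    q , n , ≤-refl , q<level , eq

  gapsByResidue-unique : .{{_ : NonZero a}} → ∀ {n} → n ≤ a → Unique (gapsByResidue a level n)
  gapsByResidue-unique {zero}  _     = []
  gapsByResidue-unique {suc n} 1+n≤a =
    ++⁺ (gapsByResidue-unique (<⇒≤ 1+n≤a))
        (applyUpTo⁺₁ _ (level n) (λ i<j _ → <⇒≢ (+-monoˡ-< n (*-monoˡ-< a i<j))))
        disjoint
    where
    disjoint : ∀ {m} → ¬ (m ∈ gapsByResidue a level n × m ∈ applyUpTo (λ q → q * a + n) (level n))
    disjoint (m∈ , m∈′)
      with q , r , r<n , _ , refl ← ∈-gapsByResidue⁻ n m∈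
         | q′ , _ , eq ← ∈-applyUpTo⁻ (λ q → q * a + n) m∈′ =
      <⇒≢ r<n (residue-unique {q = q} {q′} (<-trans r<n 1+n≤a) 1+n≤a eq)

isSylvesterNumber-byResidues : ∀ as a .{{_ : NonZero a}} (level : ℕ → ℕ) →
  (∀ q r → r < a → Representable as (q * a + r) ⇔ level r ≤ q) →
  IsSylvesterNumber as (∑[ r < a ] level r)
isSylvesterNumber-byResidues as a level rep⇔ =
  gapsByResidue a level a , gapsByResidue-unique a level ≤-refl ,
  length-gapsByResidue a level a , λ m → mk⇔ (gap⇒ m) (⇒gap m)
  where
  gap⇒ : ∀ m → m ∈ gapsByResidue a level a → 1 ≤ m × ¬ Representable as m
  gap⇒ m m∈ with q , r , r<a , q<level , refl ← ∈-gapsByResidue⁻ a level a m∈ =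
    nonrepresentable⇒positive ¬rep , ¬rep
    where
    ¬rep : ¬ Representable as (q * a + r)
    ¬rep rep = <⇒≱ q<level (to (rep⇔ q r r<a) rep)
  ⇒gap : ∀ m → 1 ≤ m × ¬ Representable as m → m ∈ gapsByResidue a level a
  ⇒gap m (_ , ¬rep) =
    subst (_∈ gapsByResidue a level a) m≡ (∈-gapsByResidue⁺ a level a (m%n<n m a) (≰⇒> level≰))
    where
    m≡ : m / a * a + m % a ≡ m
    m≡ = trans (+-comm _ (m % a)) (sym (m≡m%n+[m/n]*n m a))
    level≰ : ¬ level (m % a) ≤ m / a
    level≰ le = ¬rep (subst (Representable as) m≡ (from (rep⇔ (m / a) (m % a) (m%n<n m a)) le))

⌈_/6⌉ : ℕ → ℕ
⌈ zero /6⌉                                = 0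
⌈ suc (suc (suc (suc (suc (suc n))))) /6⌉ = suc ⌈ n /6⌉
⌈ _ /6⌉                                   = 1

⌈/6⌉≤⇒≤*6 : ∀ n {k} → ⌈ n /6⌉ ≤ k → n ≤ k * 6
⌈/6⌉≤⇒≤*6 zero                                  _         = z≤n
⌈/6⌉≤⇒≤*6 (suc (suc (suc (suc (suc (suc n)))))) (s≤s le) =
  s≤s (s≤s (s≤s (s≤s (s≤s (s≤s (⌈/6⌉≤⇒≤*6 n le))))))
⌈/6⌉≤⇒≤*6 1 {suc k} _ = m≤m+n 1 (5 + k * 6)
⌈/6⌉≤⇒≤*6 2 {suc k} _ = m≤m+n 2 (4 + k * 6)
⌈/6⌉≤⇒≤*6 3 {suc k} _ = m≤m+n 3 (3 + k * 6)
⌈/6⌉≤⇒≤*6 4 {suc k} _ = m≤m+n 4 (2 + k * 6)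
⌈/6⌉≤⇒≤*6 5 {suc k} _ = m≤m+n 5 (1 + k * 6)

≤*6⇒⌈/6⌉≤ : ∀ n k → n ≤ k * 6 → ⌈ n /6⌉ ≤ k
≤*6⇒⌈/6⌉≤ zero    _    _ = z≤n
≤*6⇒⌈/6⌉≤ (suc n) zero ()
≤*6⇒⌈/6⌉≤ (suc (suc (suc (suc (suc (suc n)))))) (suc k)
  (s≤s (s≤s (s≤s (s≤s (s≤s (s≤s le)))))) = s≤s (≤*6⇒⌈/6⌉≤ n k le)
≤*6⇒⌈/6⌉≤ 1 (suc k) _ = s≤s z≤n
≤*6⇒⌈/6⌉≤ 2 (suc k) _ = s≤s z≤n
≤*6⇒⌈/6⌉≤ 3 (suc k) _ = s≤s z≤n
≤*6⇒⌈/6⌉≤ 4 (suc k) _ = s≤s z≤n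
≤*6⇒⌈/6⌉≤ 5 (suc k) _ = s≤s z≤n

∑-⌈/6⌉-six : ∀ x → ∑[ i < 6 ] ⌈ x + i /6⌉ ≡ x + 5
∑-⌈/6⌉-six 0 = refl
∑-⌈/6⌉-six 1 = refl
∑-⌈/6⌉-six 2 = refl
∑-⌈/6⌉-six 3 = refl
∑-⌈/6⌉-six 4 = refl
∑-⌈/6⌉-six 5 = refl
∑-⌈/6⌉-six (suc (suc (suc (suc (suc (suc x)))))) =
  trans (shift ⌈ x + 0 /6⌉ ⌈ x + 1 /6⌉ ⌈ x + 2 /6⌉ ⌈ x + 3 /6⌉ ⌈ x + 4 /6⌉ ⌈ x + 5 /6⌉)
        (cong (6 +_) (∑-⌈/6⌉-six x))
  where
  shift : ∀ b c d e f g →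
    0 + suc b + suc c + suc d + suc e + suc f + suc g ≡ 6 + (0 + b + c + d + e + f + g)
  shift = solve-∀

gaps456 : List ℕ
gaps456 = 1 ∷ 2 ∷ 3 ∷ 7 ∷ []

∉gaps456 : ∀ {s} → {False (s ∈? gaps456)} → s ∉ gaps456
∉gaps456 {s} {s∉} = toWitnessFalse s∉

Sum456 : ℕ → ℕ → Set
Sum456 k s = ∃[ x₁ ] ∃[ x₂ ] ∃[ x₃ ] (x₁ + x₂ + x₃ ≤ k × x₁ * 4 + x₂ * 5 + x₃ * 6 ≡ s)

sum456-≤ : ∀ {k s} → Sum456 k s → s ≤ k * 6
sum456-≤ {k} (x₁ , x₂ , x₃ , j≤k , refl) = begin
  x₁ * 4 + x₂ * 5 + x₃ * 6                      ≤⟨ m≤m+n _ (x₁ * 2 + x₂) ⟩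
  x₁ * 4 + x₂ * 5 + x₃ * 6 + (x₁ * 2 + x₂)      ≡⟨ solve (x₁ ∷ x₂ ∷ x₃ ∷ []) ⟩
  (x₁ + x₂ + x₃) * 6                            ≤⟨ *-monoˡ-≤ 6 j≤k ⟩
  k * 6                                         ∎
  where open ≤-Reasoning

combination456∉gaps : ∀ x₁ x₂ x₃ → x₁ * 4 + x₂ * 5 + x₃ * 6 ∉ gaps456
combination456∉gaps 0              0              0              = ∉gaps456
combination456∉gaps 1              0              0              = ∉gaps456
combination456∉gaps 0              1              0              = ∉gaps456
combination456∉gaps 0              0              1              = ∉gaps456
combination456∉gaps (suc (suc x₁)) x₂             x₃             = ∉gaps456
combination456∉gaps 1              (suc x₂)       x₃             = ∉gaps456
combination456∉gaps 1              0              (suc x₃)       = ∉gaps456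
combination456∉gaps 0              (suc (suc x₂)) x₃             = ∉gaps456
combination456∉gaps 0              1              (suc x₃)       = ∉gaps456
combination456∉gaps 0              0              (suc (suc x₃)) = ∉gaps456

sum456-+6 : ∀ {k s} → Sum456 k s → Sum456 (suc k) (6 + s)
sum456-+6 {k} (x₁ , x₂ , x₃ , j≤k , refl) =
  x₁ , x₂ , suc x₃ , subst (_≤ suc k) (sym (+-suc (x₁ + x₂) x₃)) (s≤s j≤k) ,
  solve (x₁ ∷ x₂ ∷ x₃ ∷ [])

sum456-⌈/6⌉ : ∀ s → s ∉ gaps456 → Sum456 ⌈ s /6⌉ s
sum456-⌈/6⌉ 0  _  = 0 , 0 , 0 , z≤n , refl
sum456-⌈/6⌉ 1  s∉ = ⊥-elim (s∉ (here refl))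
sum456-⌈/6⌉ 2  s∉ = ⊥-elim (s∉ (there (here refl)))
sum456-⌈/6⌉ 3  s∉ = ⊥-elim (s∉ (there (there (here refl))))
sum456-⌈/6⌉ 4  _  = 1 , 0 , 0 , ≤-refl , refl
sum456-⌈/6⌉ 5  _  = 0 , 1 , 0 , ≤-refl , refl
sum456-⌈/6⌉ 6  _  = 0 , 0 , 1 , ≤-refl , refl
sum456-⌈/6⌉ 7  s∉ = ⊥-elim (s∉ (there (there (there (here refl)))))
sum456-⌈/6⌉ 8  _  = 2 , 0 , 0 , ≤-refl , refl
sum456-⌈/6⌉ 9  _  = 1 , 1 , 0 , ≤-refl , refl
sum456-⌈/6⌉ 10 _  = 0 , 2 , 0 , ≤-refl , refl
sum456-⌈/6⌉ 11 _  = 0 , 1 , 1 , ≤-refl , refl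
sum456-⌈/6⌉ 12 _  = 0 , 0 , 2 , ≤-refl , refl
sum456-⌈/6⌉ 13 _  = 2 , 1 , 0 , ≤-refl , refl
sum456-⌈/6⌉ (suc (suc (suc (suc (suc (suc s@(suc (suc (suc (suc (suc (suc (suc (suc _))))))))))))))
  _ = sum456-+6 (sum456-⌈/6⌉ s ∉gaps456)

sum456⇔ : ∀ k s → Sum456 k s ⇔ (s ∉ gaps456 × s ≤ k * 6)
sum456⇔ k s = mk⇔ sum⇒ ⇒sum
  where
  sum⇒ : Sum456 k s → s ∉ gaps456 × s ≤ k * 6
  sum⇒ sum@(x₁ , x₂ , x₃ , _ , refl) = combination456∉gaps x₁ x₂ x₃ , sum456-≤ sum
  ⇒sum : s ∉ gaps456 × s ≤ k * 6 → Sum456 k s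
  ⇒sum (s∉ , s≤k*6) with x₁ , x₂ , x₃ , j≤⌈s/6⌉ , eq ← sum456-⌈/6⌉ s s∉ =
    x₁ , x₂ , x₃ , ≤-trans j≤⌈s/6⌉ (≤*6⇒⌈/6⌉≤ s k s≤k*6) , eq

generators : ℕ → List ℕ
generators a = a ∷ a + 4 ∷ a + 5 ∷ a + 6 ∷ []

representable⇔sum456 : ∀ a m →
  Representable (generators a) m ⇔ (∃[ k ] ∃[ s ] (Sum456 k s × k * a + s ≡ m))
representable⇔sum456 a m = mk⇔ rep⇒ ⇒rep
  where
  regroup : ∀ x₀ x₁ x₂ x₃ →
    x₀ * a + (x₁ * (a + 4) + (x₂ * (a + 5) + (x₃ * (a + 6) + 0)))
      ≡ (x₀ + (x₁ + x₂ + x₃)) * a + (x₁ * 4 + x₂ * 5 + x₃ * 6)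
  regroup x₀ x₁ x₂ x₃ = solve (x₀ ∷ x₁ ∷ x₂ ∷ x₃ ∷ a ∷ [])
  rep⇒ : Representable (generators a) m → ∃[ k ] ∃[ s ] (Sum456 k s × k * a + s ≡ m)
  rep⇒ (x₀ ∷ x₁ ∷ x₂ ∷ x₃ ∷ [] , _ , eq) =
    _ , _ , (x₁ , x₂ , x₃ , m≤n+m _ x₀ , refl) , trans (sym (regroup x₀ x₁ x₂ x₃)) eq
  rep⇒ ([] , () , _)
  rep⇒ (_ ∷ [] , () , _)
  rep⇒ (_ ∷ _ ∷ [] , () , _)
  rep⇒ (_ ∷ _ ∷ _ ∷ [] , () , _)
  rep⇒ (_ ∷ _ ∷ _ ∷ _ ∷ _ ∷ _ , () , _)
  ⇒rep : ∃[ k ] ∃[ s ] (Sum456 k s × k * a + s ≡ m) → Representable (generators a) m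
  ⇒rep (k , _ , (x₁ , x₂ , x₃ , j≤k , refl) , eq) =
    (k ∸ (x₁ + x₂ + x₃)) ∷ x₁ ∷ x₂ ∷ x₃ ∷ [] , refl ,
    trans (regroup (k ∸ (x₁ + x₂ + x₃)) x₁ x₂ x₃) (trans (cong (λ t → t * a + _) (m∸n+n≡m j≤k)) eq)

euclid-cases : ∀ {a k s q r} → k * a + s ≡ q * a + r → r < a →
  (k ≡ q × s ≡ r) ⊎ (k < q × a + r ≤ s)
euclid-cases {a} {k} {s} {q} {r} eq r<a with <-cmp k q
... | tri≈ _ refl _ = inj₁ (refl , +-cancelˡ-≡ (k * a) s r eq)
... | tri< k<q _ _  = inj₂ (k<q , +-cancelˡ-≤ (k * a) (a + r) s (begin
  k * a + (a + r)   ≡⟨ +-assoc (k * a) a r ⟨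
  k * a + a + r     ≡⟨ cong (_+ r) (+-comm (k * a) a) ⟩
  suc k * a + r     ≤⟨ +-monoˡ-≤ r (*-monoˡ-≤ a k<q) ⟩
  q * a + r         ≡⟨ eq ⟨
  k * a + s         ∎))
  where open ≤-Reasoning
... | tri> _ _ q<k  = ⊥-elim (<-irrefl (sym eq) (begin-strict
  q * a + r         <⟨ +-monoʳ-< (q * a) r<a ⟩
  q * a + a         ≡⟨ +-comm (q * a) a ⟩
  suc q * a         ≤⟨ *-monoˡ-≤ a q<k ⟩
  k * a             ≤⟨ m≤m+n (k * a) s ⟩
  k * a + s         ∎))
  where open ≤-Reasoning

-- For a ≥ 8, apéryLevel a r · a + r is the least representable number congruent to r modulo a,
-- i.e. the element of the Apéry set of the semigroup with respect to a.
apéryLevel : ℕ → ℕ → ℕ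
apéryLevel a r with r ∈? gaps456
... | yes _ = suc ⌈ a + r /6⌉
... | no  _ = ⌈ r /6⌉

apéryLevel-≤ : ∀ a r → apéryLevel a r ≤ suc ⌈ a + r /6⌉
apéryLevel-≤ a r with r ∈? gaps456
... | yes _ = ≤-refl
... | no  _ = m≤n⇒m≤1+n (≤*6⇒⌈/6⌉≤ r _ (≤-trans (m≤n+m r a) (⌈/6⌉≤⇒≤*6 (a + r) ≤-refl)))

sum456⇒apéryLevel≤ : ∀ {a q r} → Sum456 q r → apéryLevel a r ≤ q
sum456⇒apéryLevel≤ {a} {q} {r} sum with r ∈? gaps456 | to (sum456⇔ q r) sum
... | yes r∈ | r∉ , _     = ⊥-elim (r∉ r∈)
... | no  _  | _ , r≤q*6 = ≤*6⇒⌈/6⌉≤ r q r≤q*6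

-- a ≥ 8 is written 8 + k, so that 8 + k + r ∉ gaps456 is decided by evaluation.
module _ (k : ℕ) where

  representable⇒apéryLevel≤ : ∀ q r → r < 8 + k →
    Representable (generators (8 + k)) (q * (8 + k) + r) → apéryLevel (8 + k) r ≤ q
  representable⇒apéryLevel≤ q r r<a rep
    with k′ , s , sum , eq ← to (representable⇔sum456 (8 + k) _) rep
    with euclid-cases {8 + k} {k′} {s} {q} {r} eq r<a
  ... | inj₁ (refl , refl)   = sum456⇒apéryLevel≤ sum
  ... | inj₂ (k′<q , a+r≤s) =
    ≤-trans (apéryLevel-≤ (8 + k) r)
            (≤-trans (s≤s (≤*6⇒⌈/6⌉≤ (8 + k + r) k′ (≤-trans a+r≤s (sum456-≤ sum)))) k′<q)

  apéryLevel≤⇒representable : ∀ q r →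
    apéryLevel (8 + k) r ≤ q → Representable (generators (8 + k)) (q * (8 + k) + r)
  apéryLevel≤⇒representable q r level≤q with r ∈? gaps456
  ... | no r∉ =
    from (representable⇔sum456 (8 + k) _)
      (q , r , from (sum456⇔ q r) (r∉ , ⌈/6⌉≤⇒≤*6 r level≤q) , refl)
  apéryLevel≤⇒representable (suc q) r (s≤s ⌈a+r/6⌉≤q) | yes _ =
    from (representable⇔sum456 (8 + k) _)
      (q , 8 + k + r , from (sum456⇔ q _) (∉gaps456 , ⌈/6⌉≤⇒≤*6 (8 + k + r) ⌈a+r/6⌉≤q) ,
       trans (sym (+-assoc (q * (8 + k)) (8 + k) r)) (cong (_+ r) (+-comm (q * (8 + k)) (8 + k))))

  representable⇔apéryLevel≤ : ∀ q r → r < 8 + k →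
    Representable (generators (8 + k)) (q * (8 + k) + r) ⇔ apéryLevel (8 + k) r ≤ q
  representable⇔apéryLevel≤ q r r<a =
    mk⇔ (representable⇒apéryLevel≤ q r r<a) (apéryLevel≤⇒representable q r)

gapCount : ℕ → ℕ
gapCount a = ∑[ r < a ] apéryLevel a r

gapCount-split : ∀ k →
  gapCount (8 + k) ≡ ∑[ r < 8 ] apéryLevel (8 + k) r + ∑[ j < k ] ⌈ 8 + j /6⌉
gapCount-split k = ∑-+ 8 k (apéryLevel (8 + k))

gapCount-+6 : ∀ k → gapCount (14 + k) ≡ gapCount (8 + k) + (17 + k)
gapCount-+6 k = begin
  gapCount (14 + k)
    ≡⟨ gapCount-split (6 + k) ⟩
  ∑[ r < 8 ] apéryLevel (14 + k) r + ∑[ j < 6 + k ] ⌈ 8 + j /6⌉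
    ≡⟨ cong₂ _+_ (head-+6 ⌈ 8 + k + 1 /6⌉ ⌈ 8 + k + 2 /6⌉ ⌈ 8 + k + 3 /6⌉ ⌈ 8 + k + 7 /6⌉) tail-+6 ⟩
  (∑[ r < 8 ] apéryLevel (8 + k) r + 4) + (∑[ j < k ] ⌈ 8 + j /6⌉ + (8 + k + 5))
    ≡⟨ regroup (∑[ r < 8 ] apéryLevel (8 + k) r) (∑[ j < k ] ⌈ 8 + j /6⌉) k ⟩
  (∑[ r < 8 ] apéryLevel (8 + k) r + ∑[ j < k ] ⌈ 8 + j /6⌉) + (17 + k)
    ≡⟨ cong (_+ (17 + k)) (gapCount-split k) ⟨
  gapCount (8 + k) + (17 + k)
    ∎
  where
  open ≡-Reasoning
  -- The shape of ∑[ r < 8 ] apéryLevel a r after unfolding: only r = 1, 2, 3, 7 depend on a,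
  -- through ⌈ a + r /6⌉, and ⌈ 6 + x /6⌉ unfolds to suc ⌈ x /6⌉.
  head-+6 : ∀ b c d e →
    0 + 0 + suc (suc b) + suc (suc c) + suc (suc d) + 1 + 1 + 1 + suc (suc e)
      ≡ 0 + 0 + suc b + suc c + suc d + 1 + 1 + 1 + suc e + 4
  head-+6 = solve-∀
  tail-+6 : ∑[ j < 6 + k ] ⌈ 8 + j /6⌉ ≡ ∑[ j < k ] ⌈ 8 + j /6⌉ + (8 + k + 5)
  tail-+6 = begin
    ∑[ j < 6 + k ] ⌈ 8 + j /6⌉
      ≡⟨ cong (λ n → ∑[ j < n ] ⌈ 8 + j /6⌉) (+-comm 6 k) ⟩
    ∑[ j < k + 6 ] ⌈ 8 + j /6⌉
      ≡⟨ ∑-+ k 6 (λ j → ⌈ 8 + j /6⌉) ⟩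
    ∑[ j < k ] ⌈ 8 + j /6⌉ + ∑[ i < 6 ] ⌈ 8 + k + i /6⌉
      ≡⟨ cong (∑[ j < k ] ⌈ 8 + j /6⌉ +_) (∑-⌈/6⌉-six (8 + k)) ⟩
    ∑[ j < k ] ⌈ 8 + j /6⌉ + (8 + k + 5)
      ∎
  regroup : ∀ h t k → h + 4 + (t + (8 + k + 5)) ≡ h + t + (17 + k)
  regroup = solve-∀

gapCount-formula : ∀ k →
  12 * gapCount (8 + k) ≡ (8 + k) * (8 + k) + 12 * (8 + k) + constTerm ((8 + k) % 6)
gapCount-formula 0 = refl
gapCount-formula 1 = refl
gapCount-formula 2 = refl
gapCount-formula 3 = refl
gapCount-formula 4 = refl
gapCount-formula 5 = refl
gapCount-formula (suc (suc (suc (suc (suc (suc k)))))) = begin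
  12 * gapCount (14 + k)
    ≡⟨ cong (12 *_) (gapCount-+6 k) ⟩
  12 * (gapCount (8 + k) + (17 + k))
    ≡⟨ *-distribˡ-+ 12 (gapCount (8 + k)) (17 + k) ⟩
  12 * gapCount (8 + k) + 12 * (17 + k)
    ≡⟨ cong (_+ 12 * (17 + k)) (gapCount-formula k) ⟩
  (8 + k) * (8 + k) + 12 * (8 + k) + c + 12 * (17 + k)
    ≡⟨ square-+6 k c ⟩
  (14 + k) * (14 + k) + 12 * (14 + k) + c
    ≡⟨ cong (λ i → (14 + k) * (14 + k) + 12 * (14 + k) + constTerm i) period ⟨
  (14 + k) * (14 + k) + 12 * (14 + k) + constTerm ((14 + k) % 6)
    ∎
  where
  open ≡-Reasoning
  c = constTerm ((8 + k) % 6)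
  square-+6 : ∀ k c →
    (8 + k) * (8 + k) + 12 * (8 + k) + c + 12 * (17 + k) ≡ (14 + k) * (14 + k) + 12 * (14 + k) + c
  square-+6 = solve-∀
  period : (14 + k) % 6 ≡ (8 + k) % 6
  period = trans (cong (_% 6) (+-comm 6 (8 + k))) ([m+n]%n≡m%n (8 + k) 6)

corollary9 : (a : ℕ) → (a ≡ 4 ⊎ a ≡ 5 ⊎ a ≡ 6 ⊎ 8 ≤ a) →
    Σ ℕ λ N → IsSylvesterNumber (a ∷ a + 4 ∷ a + 5 ∷ a + 6 ∷ []) N ×
    (12 * N ≡ a * a + 12 * a + constTerm (a % 6))
corollary9 .4 (inj₁ refl)                = -, isSylvesterNumber-byComputation 4 _ 16 , refl
corollary9 .5 (inj₂ (inj₁ refl))         = -, isSylvesterNumber-byComputation 5 _ 18 , refl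
corollary9 .6 (inj₂ (inj₂ (inj₁ refl)))  = -, isSylvesterNumber-byComputation 6 _ 26 , refl
corollary9 a  (inj₂ (inj₂ (inj₂ 8≤a))) with k , refl ← m≤n⇒∃[o]m+o≡n 8≤a =
  gapCount (8 + k) ,
  isSylvesterNumber-byResidues (generators (8 + k)) (8 + k) (apéryLevel (8 + k))
    (representable⇔apéryLevel≤ k) ,
  gapCount-formula k
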